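{- Let $G$ be a graph of order $n_G$ with no isolated vertices. Then $n_G-\gamma(G)\leq \operatorname{ZIR}(G\vee K_1)\leq n_G-\gamma(G)+1$. If $\operatorname{ZIR}(G)=n_G-\gamma(G)$, then $\operatorname{ZIR}(G\vee K_1)=n_G-\gamma(G)+1=\operatorname{ZIR}(G)+1$. Both bounds in the displayed inequality are sharp (each holds with equality for some such $G$).
   Context: $G\vee K_1$ is $G$ with one new vertex adjacent to all vertices of $G$. $\gamma(G)$ is the domination number (minimum size of a set $D$ such that every vertex is in $D$ or adjacent to a vertex of $D$). A fort is a nonempty vertex subset $F$ such that every vertex $v\notin F$ has $|F\cap N(v)|\neq 1$. For $S$ and $x\in S$, a private fort of $x$ relative to $S$ is a fort $F$ with $S\cap F=\{x\}$; $S$ is a ZIr-set if every element has a private fort. $\operatorname{ZIR}(G)$ is the maximum cardinality of an inclusion-maximal ZIr-set of $G$. -}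

module Defs where

open import Data.Nat using (ℕ; zero; suc; _≤_)
open import Data.Fin using (Fin; zero; suc)
open import Data.Fin.Subset using (Subset; _∈_; _∉_; _⊆_; _∩_; ∣_∣; ⁅_⁆)
open import Data.Vec using (tabulate)
open import Data.Empty using (⊥)
open import Data.Unit using (⊤)
open import Data.Product using (Σ; ∃; _×_; _,_)
open import Data.Sum using (_⊎_)
open import Relation.Nullary using (¬_; Dec; does; yes; no)
open import Relation.Binary.PropositionalEquality using (_≡_; _≢_)

record Graph (n : ℕ) : Set₁ where
  field
    _~_     : Fin n → Fin n → Set
    ~-sym   : ∀ {u v} → u ~ v → v ~ u
    ~-irrefl : ∀ {u} → ¬ (u ~ u)
    ~-dec   : ∀ u v → Dec (u ~ v)
open Graph public

N : ∀ {n} → Graph n → Fin n → Subset n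
N G v = tabulate (λ u → does (~-dec G v u))

NoIsolated : ∀ {n} → Graph n → Set
NoIsolated G = ∀ v → ∃ λ u → _~_ G v u

Dominating : ∀ {n} → Graph n → Subset n → Set
Dominating G D = ∀ v → v ∈ D ⊎ (∃ λ u → u ∈ D × _~_ G v u)

IsDominationNumber : ∀ {n} → Graph n → ℕ → Set
IsDominationNumber G g =
  (∃ λ D → Dominating G D × ∣ D ∣ ≡ g) × (∀ D → Dominating G D → g ≤ ∣ D ∣)

IsFort : ∀ {n} → Graph n → Subset n → Set
IsFort G F = (∃ λ x → x ∈ F) × (∀ v → v ∉ F → ∣ F ∩ N G v ∣ ≢ 1)

PrivateFort : ∀ {n} → Graph n → Subset n → Fin n → Subset n → Set
PrivateFort G S x F = IsFort G F × (S ∩ F ≡ ⁅ x ⁆)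

IsZIrSet : ∀ {n} → Graph n → Subset n → Set
IsZIrSet G S = ∀ x → x ∈ S → ∃ λ F → PrivateFort G S x F

MaximalZIrSet : ∀ {n} → Graph n → Subset n → Set
MaximalZIrSet G S = IsZIrSet G S × (∀ T → S ⊆ T → IsZIrSet G T → T ≡ S)

IsZIR : ∀ {n} → Graph n → ℕ → Set
IsZIR G z =
  (∃ λ S → MaximalZIrSet G S × ∣ S ∣ ≡ z) × (∀ S → MaximalZIrSet G S → ∣ S ∣ ≤ z)

-- Join G ∨ K₁: new vertex is zero, old vertex i becomes suc i.
JAdj : ∀ {n} → Graph n → Fin (suc n) → Fin (suc n) → Set
JAdj G zero zero = ⊥
JAdj G zero (suc j) = ⊤
JAdj G (suc i) zero = ⊤
JAdj G (suc i) (suc j) = _~_ G i j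

private
  jsym : ∀ {n} (G : Graph n) {u v} → JAdj G u v → JAdj G v u
  jsym G {zero} {zero} ()
  jsym G {zero} {suc j} p = p
  jsym G {suc i} {zero} p = p
  jsym G {suc i} {suc j} p = ~-sym G p

  jirr : ∀ {n} (G : Graph n) {u} → ¬ JAdj G u u
  jirr G {zero} ()
  jirr G {suc i} p = ~-irrefl G p

  jdec : ∀ {n} (G : Graph n) u v → Dec (JAdj G u v)
  jdec G zero zero = no (λ ())
  jdec G zero (suc j) = yes _
  jdec G (suc i) zero = yes _
  jdec G (suc i) (suc j) = ~-dec G i j

_∨K₁ : ∀ {n} → Graph n → Graph (suc n)
G ∨K₁ = record { _~_ = JAdj G ; ~-sym = λ {u} {v} → jsym G {u} {v} ; ~-irrefl = λ {u} → jirr G {u} ; ~-dec = jdec G }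

{-# OPTIONS --safe #-}
-- Write a for the apex of G ∨ K₁. A set D ∪ {a} is a fort of G ∨ K₁ exactly when D dominates
-- G, and (G having no isolated vertices) a set avoiding a is a fort of G ∨ K₁ exactly when it is
-- a fort of G, since a fort of G is then never a singleton.
-- For a minimum dominating set D, the vertices outside D form a ZIr-set of G ∨ K₁, the private
-- fort of v being D ∪ {v, a}; hence n − γ ≤ ZIR(G ∨ K₁).
-- Let S be a ZIr-set of G ∨ K₁. If some private fort contains a, it restricts to a dominating set
-- of G meeting S in at most one vertex, so |S| + γ ≤ n + 1. Otherwise S is a ZIr-set of G, and its
-- complement dominates G: a vertex v ∈ S adjacent to y ∈ S lies outside the private fort of y,
-- so it sees a second vertex of that fort, which is not in S. Then |S| + γ ≤ n.
-- A ZIr-set S of G together with a is a ZIr-set of G ∨ K₁ (a has the private fort (V − S) ∪ {a}),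
-- which gives the equality case. Sharpness is witnessed by P₃ = star 2 and K₂ = star 1, checked by
-- exhaustive search.
module Submission where

open import Defs
open import Data.Nat using (ℕ; suc; _+_; _∸_; _≤_; _<_; s≤s; _≤?_; _≟_)
open import Data.Nat.Properties
  using (≤-trans; ≤-reflexive; ≤-antisym; <⇒≤; <⇒≱; >⇒≢; ≰⇒>; m≤n⇒m≤1+n; suc-injective;
         +-comm; +-assoc; +-suc; +-monoˡ-≤; +-monoʳ-≤; ∸-monoʳ-<; m+n≤o⇒m≤o∸n; m≤n+o⇒m∸n≤o;
         m≤n+m∸n; m+[n∸m]≡n;
         module ≤-Reasoning)
open import Data.Nat.Induction using (<-wellFounded)
open import Data.Fin using (Fin; zero; suc)
open import Data.Fin.Properties using (all?; any?) renaming (_≟_ to _≟ᶠ_)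
open import Data.Fin.Subset
  using (Subset; inside; outside; _∈_; _∉_; _⊆_; _∩_; _∪_; ∁; ∣_∣; ⁅_⁆; ⊥; ⊤; Nonempty)
open import Data.Fin.Subset.Properties
  using (_∈?_; _⊆?_; nonempty?; anySubset?; Empty-unique; ∣⊥∣≡0; ∣⁅x⁆∣≡1; ∣p∣≤n; ∣∁p∣≡n∸∣p∣;
         x∈⁅x⁆; x∈⁅y⁆⇒x≡y; ⊆-antisym; p⊆q⇒∣p∣≤∣q∣; p⊂q⇒∣p∣<∣q∣; drop-there; x∉p⇒x∈∁p;
         x∈p∩q⁺; x∈p∩q⁻; p∩q⊆q; ∣p∩q∣≤∣p∣; p⊆p∪q; ∩-distribˡ-∪; ∩-inverseˡ; ∩-inverseʳ;
         ∩-identityʳ; ∪-identityˡ)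
open import Data.Bool using () renaming (_≟_ to _≟ᴮ_)
open import Data.Vec using ([]; _∷_; here; there)
open import Data.Vec.Properties
  using (≡-dec; ∷-injectiveʳ; lookup∘tabulate; []=⇒lookup; lookup⇒[]=; tabulate-cong;
         tabulate∘lookup; lookup-replicate)
import Data.Empty as Empty
open import Data.Product using (Σ; ∃; _×_; _,_; proj₂)
open import Data.Sum using (inj₁; inj₂)
open import Function using (_∘_; _on_; case_of_)
open import Induction.WellFounded using (Acc; acc)
import Relation.Binary.Construct.On as On
open import Relation.Nullary using (Dec; yes; no; ¬_; ¬?; contradiction)
open import Relation.Nullary.Decidable
  using (_×-dec_; _⊎-dec_; _→-dec_; map′; decidable-stable; dec-true; dec-false; from-yes)
open import Relation.Unary using (Decidable)
open import Relation.Binary.PropositionalEquality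
  using (_≡_; _≢_; refl; sym; trans; cong; subst; module ≡-Reasoning)

private
  variable
    n : ℕ
    x y : Fin n
    p q : Subset n

x∈p⇒⁅x⁆⊆p : x ∈ p → ⁅ x ⁆ ⊆ p
x∈p⇒⁅x⁆⊆p {x = x} x∈p y∈⁅x⁆ = subst (_∈ _) (sym (x∈⁅y⁆⇒x≡y x y∈⁅x⁆)) x∈p

x∈p⇒0<∣p∣ : x ∈ p → 0 < ∣ p ∣
x∈p⇒0<∣p∣ {x = x} x∈p = subst (_≤ _) (∣⁅x⁆∣≡1 x) (p⊆q⇒∣p∣≤∣q∣ (x∈p⇒⁅x⁆⊆p x∈p))

∣p∣≢0⇒nonempty : ∀ (p : Subset n) → ∣ p ∣ ≢ 0 → Nonempty p
∣p∣≢0⇒nonempty {n} p ∣p∣≢0 = decidable-stable (nonempty? p) λ empty →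
  ∣p∣≢0 (trans (cong ∣_∣ (Empty-unique empty)) (∣⊥∣≡0 n))

p⊆q∧∣q∣≤∣p∣⇒p≡q : p ⊆ q → ∣ q ∣ ≤ ∣ p ∣ → p ≡ q
p⊆q∧∣q∣≤∣p∣⇒p≡q {p = p} p⊆q ∣q∣≤∣p∣ = ⊆-antisym p⊆q λ {x} x∈q →
  decidable-stable (x ∈? p) λ x∉p → <⇒≱ (p⊂q⇒∣p∣<∣q∣ (p⊆q , x , x∈q , x∉p)) ∣q∣≤∣p∣

∣p∣≡1⇒p≡⁅x⁆ : ∣ p ∣ ≡ 1 → x ∈ p → p ≡ ⁅ x ⁆
∣p∣≡1⇒p≡⁅x⁆ {x = x} ∣p∣≡1 x∈p =
  sym (p⊆q∧∣q∣≤∣p∣⇒p≡q (x∈p⇒⁅x⁆⊆p x∈p) (≤-reflexive (trans ∣p∣≡1 (sym (∣⁅x⁆∣≡1 x)))))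

∣p∣≢1⇒∈-other : ∣ p ∣ ≢ 1 → y ∈ p → ∃ λ w → w ∈ p × w ≢ y
∣p∣≢1⇒∈-other {p = p} {y = y} ∣p∣≢1 y∈p =
  decidable-stable (any? λ w → w ∈? p ×-dec ¬? (w ≟ᶠ y)) λ ∄other →
    let p⊆⁅y⁆ : p ⊆ ⁅ y ⁆
        p⊆⁅y⁆ {w} w∈p = subst (_∈ ⁅ y ⁆)
          (sym (decidable-stable (w ≟ᶠ y) λ w≢y → ∄other (w , w∈p , w≢y))) (x∈⁅x⁆ y)
    in ∣p∣≢1 (trans (cong ∣_∣ (⊆-antisym p⊆⁅y⁆ (x∈p⇒⁅x⁆⊆p y∈p))) (∣⁅x⁆∣≡1 y))

∣p∣+∣q∣≡∣p∩q∣+∣p∪q∣ : ∀ (p q : Subset n) → ∣ p ∣ + ∣ q ∣ ≡ ∣ p ∩ q ∣ + ∣ p ∪ q ∣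
∣p∣+∣q∣≡∣p∩q∣+∣p∪q∣ []            []            = refl
∣p∣+∣q∣≡∣p∩q∣+∣p∪q∣ (inside  ∷ p) (inside  ∷ q) = cong suc (trans (+-suc ∣ p ∣ ∣ q ∣)
  (trans (cong suc (∣p∣+∣q∣≡∣p∩q∣+∣p∪q∣ p q)) (sym (+-suc ∣ p ∩ q ∣ ∣ p ∪ q ∣))))
∣p∣+∣q∣≡∣p∩q∣+∣p∪q∣ (inside  ∷ p) (outside ∷ q) =
  trans (cong suc (∣p∣+∣q∣≡∣p∩q∣+∣p∪q∣ p q)) (sym (+-suc ∣ p ∩ q ∣ ∣ p ∪ q ∣))
∣p∣+∣q∣≡∣p∩q∣+∣p∪q∣ (outside ∷ p) (inside  ∷ q) = trans (+-suc ∣ p ∣ ∣ q ∣)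
  (trans (cong suc (∣p∣+∣q∣≡∣p∩q∣+∣p∪q∣ p q)) (sym (+-suc ∣ p ∩ q ∣ ∣ p ∪ q ∣)))
∣p∣+∣q∣≡∣p∩q∣+∣p∪q∣ (outside ∷ p) (outside ∷ q) = ∣p∣+∣q∣≡∣p∩q∣+∣p∪q∣ p q

∣p∣+∣q∣≤∣p∩q∣+n : ∀ (p q : Subset n) → ∣ p ∣ + ∣ q ∣ ≤ ∣ p ∩ q ∣ + n
∣p∣+∣q∣≤∣p∩q∣+n p q = begin
  ∣ p ∣ + ∣ q ∣         ≡⟨ ∣p∣+∣q∣≡∣p∩q∣+∣p∪q∣ p q ⟩
  ∣ p ∩ q ∣ + ∣ p ∪ q ∣ ≤⟨ +-monoʳ-≤ ∣ p ∩ q ∣ (∣p∣≤n (p ∪ q)) ⟩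
  ∣ p ∩ q ∣ + _         ∎
  where open ≤-Reasoning

p∩⁅x⁆≡⁅x⁆ : x ∈ p → p ∩ ⁅ x ⁆ ≡ ⁅ x ⁆
p∩⁅x⁆≡⁅x⁆ {x = x} {p = p} x∈p =
  ⊆-antisym (p∩q⊆q p ⁅ x ⁆) λ y∈⁅x⁆ → x∈p∩q⁺ (x∈p⇒⁅x⁆⊆p x∈p y∈⁅x⁆ , y∈⁅x⁆)

∁p∩[p∪q]≡∁p∩q : ∀ (p q : Subset n) → ∁ p ∩ (p ∪ q) ≡ ∁ p ∩ q
∁p∩[p∪q]≡∁p∩q p q = begin
  ∁ p ∩ (p ∪ q)           ≡⟨ ∩-distribˡ-∪ (∁ p) p q ⟩
  (∁ p ∩ p) ∪ (∁ p ∩ q)   ≡⟨ cong (_∪ (∁ p ∩ q)) (∩-inverseˡ p) ⟩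
  ⊥ ∪ (∁ p ∩ q)           ≡⟨ ∪-identityˡ (∁ p ∩ q) ⟩
  ∁ p ∩ q                 ∎
  where open ≡-Reasoning

m+n≤1+o⇒m≤o∸n+1 : ∀ m n o → m + n ≤ suc o → m ≤ o ∸ n + 1
m+n≤1+o⇒m≤o∸n+1 m n o m+n≤1+o = ≤-trans (m+n≤o⇒m≤o∸n m m+n≤1+o) (m≤n+o⇒m∸n≤o (suc o) n (begin
  suc o             ≡⟨ +-comm 1 o ⟩
  o + 1             ≤⟨ +-monoˡ-≤ 1 (m≤n+m∸n o n) ⟩
  n + (o ∸ n) + 1   ≡⟨ +-assoc n (o ∸ n) 1 ⟩
  n + (o ∸ n + 1)   ∎))
  where open ≤-Reasoning

-- A maximal extension of S cannot be chosen constructively; instead, the conclusion being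
-- decidable, a counterexample S is shown to be maximal, by induction on n − |S|.
∣maximal∣≤⇒∣P∣≤ : ∀ {P : Subset n → Set} {z} →
  (∀ S → P S → (∀ T → S ⊆ T → P T → T ≡ S) → ∣ S ∣ ≤ z) → ∀ S → P S → ∣ S ∣ ≤ z
∣maximal∣≤⇒∣P∣≤ {n} {P} {z} ∣maximal∣≤ S = go S (On.wellFounded codim <-wellFounded S)
  where
  codim : Subset n → ℕ
  codim S = n ∸ ∣ S ∣
  go : ∀ S → Acc (_<_ on codim) S → P S → ∣ S ∣ ≤ z
  go S (acc larger) PS = decidable-stable (∣ S ∣ ≤? z) λ ∣S∣≰z →
    ∣S∣≰z (∣maximal∣≤ S PS (S-maximal ∣S∣≰z))
    where
    S-maximal : ¬ ∣ S ∣ ≤ z → ∀ T → S ⊆ T → P T → T ≡ S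
    S-maximal ∣S∣≰z T S⊆T PT with ∣ T ∣ ≤? ∣ S ∣
    ... | yes ∣T∣≤∣S∣ = sym (p⊆q∧∣q∣≤∣p∣⇒p≡q S⊆T ∣T∣≤∣S∣)
    ... | no ∣T∣≰∣S∣ = contradiction (≤-trans (<⇒≤ ∣S∣<∣T∣) ∣T∣≤z) ∣S∣≰z
      where
      ∣S∣<∣T∣ : ∣ S ∣ < ∣ T ∣
      ∣S∣<∣T∣ = ≰⇒> ∣T∣≰∣S∣
      ∣T∣≤z : ∣ T ∣ ≤ z
      ∣T∣≤z = go T (larger (∸-monoʳ-< ∣S∣<∣T∣ (∣p∣≤n T))) PT

module _ (G : Graph n) where

  ~⇒∈N : ∀ {v u} → _~_ G v u → u ∈ N G v
  ~⇒∈N {v} {u} v~u = lookup⇒[]= u _ (trans (lookup∘tabulate _ u) (dec-true (~-dec G v u) v~u))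

  ∈N⇒~ : ∀ {v u} → u ∈ N G v → _~_ G v u
  ∈N⇒~ {v} {u} u∈N = decidable-stable (~-dec G v u) λ ¬v~u →
    case trans (sym ([]=⇒lookup u∈N)) (trans (lookup∘tabulate _ u) (dec-false (~-dec G v u) ¬v~u))
    of λ ()

  N-apex : N (G ∨K₁) zero ≡ outside ∷ ⊤
  N-apex = cong (outside ∷_)
    (trans (tabulate-cong λ i → sym (lookup-replicate i inside)) (tabulate∘lookup ⊤))

  Dominating-mono : ∀ {D D′} → D ⊆ D′ → Dominating G D → Dominating G D′
  Dominating-mono D⊆D′ dom v with dom v
  ... | inj₁ v∈D                = inj₁ (D⊆D′ v∈D)
  ... | inj₂ (u , u∈D , v~u)    = inj₂ (u , D⊆D′ u∈D , v~u)

  apexFort⇒dominating : ∀ {D} → IsFort (G ∨K₁) (inside ∷ D) → Dominating G D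
  apexFort⇒dominating {D} (_ , fort) v with v ∈? D
  ... | yes v∈D = inj₁ v∈D
  ... | no v∉D =
    let u , u∈D∩Nv = ∣p∣≢0⇒nonempty (D ∩ N G v) (fort (suc v) (v∉D ∘ drop-there) ∘ cong suc)
        u∈D , u∈Nv = x∈p∩q⁻ D (N G v) u∈D∩Nv
    in inj₂ (u , u∈D , ∈N⇒~ u∈Nv)

  dominating⇒apexFort : ∀ {D} → Dominating G D → IsFort (G ∨K₁) (inside ∷ D)
  dominating⇒apexFort {D} dom = (zero , here) , outsider
    where
    outsider : ∀ v → v ∉ inside ∷ D → ∣ (inside ∷ D) ∩ N (G ∨K₁) v ∣ ≢ 1
    outsider zero    v∉ = contradiction here v∉
    outsider (suc v) v∉ with dom v
    ... | inj₁ v∈D             = contradiction (there v∈D) v∉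
    ... | inj₂ (u , u∈D , v~u) = >⇒≢ (x∈p⇒0<∣p∣ (x∈p∩q⁺ (u∈D , ~⇒∈N v~u))) ∘ suc-injective

  -- A neighbour of the only vertex of a singleton fort would see exactly one vertex of it.
  fort⇒∣F∣≢1 : NoIsolated G → ∀ {F} → IsFort G F → ∣ F ∣ ≢ 1
  fort⇒∣F∣≢1 noIso {F} ((x , x∈F) , fort) ∣F∣≡1 with noIso x
  ... | y , x~y with y ∈? F
  ... | yes y∈F = ~-irrefl G (subst (_~_ G x) y≡x x~y)
    where
    y≡x : y ≡ x
    y≡x = x∈⁅y⁆⇒x≡y x (subst (y ∈_) (∣p∣≡1⇒p≡⁅x⁆ ∣F∣≡1 x∈F) y∈F)
  ... | no y∉F = fort y y∉F (≤-antisym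
    (≤-trans (∣p∩q∣≤∣p∣ F (N G y)) (≤-reflexive ∣F∣≡1))
    (x∈p⇒0<∣p∣ (x∈p∩q⁺ (x∈F , ~⇒∈N (~-sym G x~y)))))

  fort⇒∨K₁-fort : NoIsolated G → ∀ {F} → IsFort G F → IsFort (G ∨K₁) (outside ∷ F)
  fort⇒∨K₁-fort noIso {F} F-fort@((x , x∈F) , fort) = (suc x , there x∈F) , outsider
    where
    outsider : ∀ v → v ∉ outside ∷ F → ∣ (outside ∷ F) ∩ N (G ∨K₁) v ∣ ≢ 1
    outsider zero    _  ∣F∩N∣≡1 = fort⇒∣F∣≢1 noIso F-fort (begin
      ∣ F ∣                               ≡⟨ cong ∣_∣ (∩-identityʳ F) ⟨
      ∣ F ∩ ⊤ ∣                           ≡⟨ cong (λ X → ∣ (outside ∷ F) ∩ X ∣) N-apex ⟨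
      ∣ (outside ∷ F) ∩ N (G ∨K₁) zero ∣  ≡⟨ ∣F∩N∣≡1 ⟩
      1                                   ∎)
      where open ≡-Reasoning
    outsider (suc v) v∉ = fort v (v∉ ∘ there)

  ∨K₁-fort⇒fort : ∀ {F} → IsFort (G ∨K₁) (outside ∷ F) → IsFort G F
  ∨K₁-fort⇒fort ((zero , ()) , _)
  ∨K₁-fort⇒fort ((suc x , there x∈F) , fort) = (x , x∈F) , λ v v∉F → fort (suc v) (v∉F ∘ drop-there)

  privateFort⇒neighbour∉ : ∀ {S y F v} → PrivateFort G S y F → v ∈ S → _~_ G v y →
                                ∃ λ w → w ∉ S × _~_ G v w
  privateFort⇒neighbour∉ {S} {y} {F} {v} ((_ , fort) , S∩F≡⁅y⁆) v∈S v~y =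
    let w , w∈F∩Nv , w≢y = ∣p∣≢1⇒∈-other (fort v v∉F) (x∈p∩q⁺ (y∈F , ~⇒∈N v~y))
        w∈F , w∈Nv = x∈p∩q⁻ F (N G v) w∈F∩Nv
    in w , (λ w∈S → w≢y (≡y w∈S w∈F)) , ∈N⇒~ w∈Nv
    where
    ≡y : ∀ {x} → x ∈ S → x ∈ F → x ≡ y
    ≡y x∈S x∈F = x∈⁅y⁆⇒x≡y y (subst (_ ∈_) S∩F≡⁅y⁆ (x∈p∩q⁺ (x∈S , x∈F)))
    y∈F : y ∈ F
    y∈F = proj₂ (x∈p∩q⁻ S F (subst (y ∈_) (sym S∩F≡⁅y⁆) (x∈⁅x⁆ y)))
    v∉F : v ∉ F
    v∉F v∈F = ~-irrefl G (subst (_~_ G v) (sym (≡y v∈S v∈F)) v~y)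

  ZIrSet⇒∁-dominating : NoIsolated G → ∀ {S} → IsZIrSet G S → Dominating G (∁ S)
  ZIrSet⇒∁-dominating noIso {S} zir v with v ∈? S
  ... | no v∉S = inj₁ (x∉p⇒x∈∁p v∉S)
  ... | yes v∈S with noIso v
  ... | y , v~y with y ∈? S
  ... | no y∉S  = inj₂ (y , x∉p⇒x∈∁p y∉S , v~y)
  ... | yes y∈S =
    let w , w∉S , v~w = privateFort⇒neighbour∉ (proj₂ (zir y y∈S)) v∈S v~y
    in inj₂ (w , x∉p⇒x∈∁p w∉S , v~w)

  dominating⇒∁-ZIrSet-∨K₁ : ∀ {D} → Dominating G D → IsZIrSet (G ∨K₁) (outside ∷ ∁ D)
  dominating⇒∁-ZIrSet-∨K₁ {D} dom (suc i) (there i∈∁D) =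
    inside ∷ (D ∪ ⁅ i ⁆) ,
    dominating⇒apexFort (Dominating-mono (p⊆p∪q ⁅ i ⁆) dom) ,
    cong (outside ∷_) (trans (∁p∩[p∪q]≡∁p∩q D ⁅ i ⁆) (p∩⁅x⁆≡⁅x⁆ i∈∁D))

  ZIrSet⇒ZIrSet-∨K₁ : NoIsolated G → ∀ {S} → IsZIrSet G S → IsZIrSet (G ∨K₁) (inside ∷ S)
  ZIrSet⇒ZIrSet-∨K₁ noIso {S} zir zero here =
    inside ∷ ∁ S ,
    dominating⇒apexFort (ZIrSet⇒∁-dominating noIso zir) ,
    cong (inside ∷_) (∩-inverseʳ S)
  ZIrSet⇒ZIrSet-∨K₁ noIso zir (suc x) (there x∈S) =
    let F , F-fort , S∩F≡⁅x⁆ = zir x x∈S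
    in outside ∷ F , fort⇒∨K₁-fort noIso F-fort , cong (outside ∷_) S∩F≡⁅x⁆

∣ZIrSet∣≤ZIR : ∀ {G : Graph n} {z S} → IsZIR G z → IsZIrSet G S → ∣ S ∣ ≤ z
∣ZIrSet∣≤ZIR (_ , ∣maximal∣≤z) = ∣maximal∣≤⇒∣P∣≤ (λ S zir maximal → ∣maximal∣≤z S (zir , maximal)) _

module _ {G : Graph n} {g : ℕ} (γ≤ : ∀ D → Dominating G D → g ≤ ∣ D ∣) where

  ∣ZIrSet∣+γ≤n : NoIsolated G → ∀ {S} → IsZIrSet G S → ∣ S ∣ + g ≤ n
  ∣ZIrSet∣+γ≤n noIso {S} zir = begin
    ∣ S ∣ + g              ≤⟨ +-monoʳ-≤ ∣ S ∣ (γ≤ (∁ S) (ZIrSet⇒∁-dominating G noIso zir)) ⟩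
    ∣ S ∣ + ∣ ∁ S ∣        ≡⟨ cong (∣ S ∣ +_) (∣∁p∣≡n∸∣p∣ S) ⟩
    ∣ S ∣ + (n ∸ ∣ S ∣)    ≡⟨ m+[n∸m]≡n (∣p∣≤n S) ⟩
    n                      ∎
    where open ≤-Reasoning

  apexFort⇒∣S∣+γ≤∣X∣+n : ∀ {F} → IsFort (G ∨K₁) (inside ∷ F) → ∀ {S X} → S ∩ F ≡ X →
                         ∣ S ∣ + g ≤ ∣ X ∣ + n
  apexFort⇒∣S∣+γ≤∣X∣+n {F} fort {S} refl =
    ≤-trans (+-monoʳ-≤ ∣ S ∣ (γ≤ F (apexFort⇒dominating G fort))) (∣p∣+∣q∣≤∣p∩q∣+n S F)

  ∣ZIrSet-∨K₁∣+γ≤1+n : NoIsolated G → ∀ S → IsZIrSet (G ∨K₁) S → ∣ S ∣ + g ≤ suc n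
  ∣ZIrSet-∨K₁∣+γ≤1+n _ (inside ∷ S) zir with zir zero here
  ... | inside ∷ F , fort , S∩F≡⊥ = s≤s (≤-trans
          (apexFort⇒∣S∣+γ≤∣X∣+n fort (∷-injectiveʳ S∩F≡⊥)) (≤-reflexive (cong (_+ n) (∣⊥∣≡0 n))))
  ∣ZIrSet-∨K₁∣+γ≤1+n noIso (outside ∷ S) zir =
    decidable-stable (∣ S ∣ + g ≤? suc n) λ ∣S∣+γ≰1+n →
      ∣S∣+γ≰1+n (m≤n⇒m≤1+n (∣ZIrSet∣+γ≤n noIso (ZIrSet-of-G ∣S∣+γ≰1+n)))
    where
    -- A private fort through the apex would already give the bound.
    ZIrSet-of-G : ¬ ∣ S ∣ + g ≤ suc n → IsZIrSet G S
    ZIrSet-of-G ∣S∣+γ≰1+n x x∈S with zir (suc x) (there x∈S)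
    ... | outside ∷ F , fort , S∩F≡⁅x⁆ = F , ∨K₁-fort⇒fort G fort , ∷-injectiveʳ S∩F≡⁅x⁆
    ... | inside ∷ F , fort , S∩F≡⁅x⁆ = contradiction (≤-trans
          (apexFort⇒∣S∣+γ≤∣X∣+n fort (∷-injectiveʳ S∩F≡⁅x⁆))
          (≤-reflexive (cong (_+ n) (∣⁅x⁆∣≡1 x)))) ∣S∣+γ≰1+n

  ZIR-∨K₁-≤ : NoIsolated G → ∀ {z} → IsZIR (G ∨K₁) z → z ≤ n ∸ g + 1
  ZIR-∨K₁-≤ noIso ((S , (zir , _) , ∣S∣≡z) , _) =
    subst (_≤ n ∸ g + 1) ∣S∣≡z (m+n≤1+o⇒m≤o∸n+1 ∣ S ∣ g n (∣ZIrSet-∨K₁∣+γ≤1+n noIso S zir))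

  ZIR-∨K₁-≡ : NoIsolated G → ∀ {S z} → IsZIrSet G S → ∣ S ∣ ≡ n ∸ g → IsZIR (G ∨K₁) z →
              z ≡ n ∸ g + 1
  ZIR-∨K₁-≡ noIso {S} {z} zirS ∣S∣≡n∸g zir = ≤-antisym (ZIR-∨K₁-≤ noIso zir) (begin
    n ∸ g + 1        ≡⟨ +-comm (n ∸ g) 1 ⟩
    suc (n ∸ g)      ≡⟨ cong suc ∣S∣≡n∸g ⟨
    ∣ inside ∷ S ∣   ≤⟨ ∣ZIrSet∣≤ZIR {G = G ∨K₁} zir (ZIrSet⇒ZIrSet-∨K₁ G noIso zirS) ⟩
    z                ∎)
    where open ≤-Reasoning

ZIR-∨K₁-≥ : ∀ {G : Graph n} {D z} → Dominating G D → IsZIR (G ∨K₁) z → n ∸ ∣ D ∣ ≤ z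
ZIR-∨K₁-≥ {G = G} {D} dom zir =
  subst (_≤ _) (∣∁p∣≡n∸∣p∣ D) (∣ZIrSet∣≤ZIR {G = G ∨K₁} zir (dominating⇒∁-ZIrSet-∨K₁ G dom))

allSubsets? : ∀ {P : Subset n → Set} → Decidable P → Dec (∀ S → P S)
allSubsets? P? = map′ (λ ∄¬P S → decidable-stable (P? S) λ ¬PS → ∄¬P (S , ¬PS))
                      (λ ∀P (S , ¬PS) → ¬PS (∀P S))
                      (¬? (anySubset? (¬? ∘ P?)))

module _ (G : Graph n) where

  noIsolated? : Dec (NoIsolated G)
  noIsolated? = all? λ v → any? (~-dec G v)

  dominating? : Decidable (Dominating G)
  dominating? D = all? λ v → v ∈? D ⊎-dec any? λ u → u ∈? D ×-dec ~-dec G v u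

  isDominationNumber? : Decidable (IsDominationNumber G)
  isDominationNumber? g = anySubset? (λ D → dominating? D ×-dec ∣ D ∣ ≟ g)
                    ×-dec allSubsets? (λ D → dominating? D →-dec g ≤? ∣ D ∣)

  isFort? : Decidable (IsFort G)
  isFort? F = nonempty? F ×-dec all? λ v → ¬? (v ∈? F) →-dec ¬? (∣ F ∩ N G v ∣ ≟ 1)

  privateFort? : ∀ S x → Decidable (PrivateFort G S x)
  privateFort? S x F = isFort? F ×-dec ≡-dec _≟ᴮ_ (S ∩ F) ⁅ x ⁆

  isZIrSet? : Decidable (IsZIrSet G)
  isZIrSet? S = all? λ x → x ∈? S →-dec anySubset? (privateFort? S x)

  maximalZIrSet? : Decidable (MaximalZIrSet G)
  maximalZIrSet? S =
    isZIrSet? S ×-dec allSubsets? λ T → S ⊆? T →-dec isZIrSet? T →-dec ≡-dec _≟ᴮ_ T S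

  isZIR? : Decidable (IsZIR G)
  isZIR? z = anySubset? (λ S → maximalZIrSet? S ×-dec ∣ S ∣ ≟ z)
       ×-dec allSubsets? (λ S → maximalZIrSet? S →-dec ∣ S ∣ ≤? z)

edgeless : ∀ n → Graph n
edgeless n = record
  { _~_ = λ _ _ → Empty.⊥ ; ~-sym = λ () ; ~-irrefl = λ () ; ~-dec = λ _ _ → no λ () }

star : ∀ n → Graph (suc n)
star n = edgeless n ∨K₁

proposition6p3 :
    ((n : ℕ) (G : Graph n) (g z : ℕ) → NoIsolated G → IsDominationNumber G g →
      IsZIR (G ∨K₁) z → (n ∸ g ≤ z) × (z ≤ n ∸ g + 1))
    × ((n : ℕ) (G : Graph n) (g z zj : ℕ) → NoIsolated G → IsDominationNumber G g →
      IsZIR G z → IsZIR (G ∨K₁) zj → z ≡ n ∸ g →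
      (zj ≡ n ∸ g + 1) × (n ∸ g + 1 ≡ z + 1))
    × (Σ ℕ λ n → Σ (Graph n) λ G → Σ ℕ λ g → Σ ℕ λ zj →
      NoIsolated G × IsDominationNumber G g × IsZIR (G ∨K₁) zj × (zj ≡ n ∸ g))
    × (Σ ℕ λ n → Σ (Graph n) λ G → Σ ℕ λ g → Σ ℕ λ zj →
      NoIsolated G × IsDominationNumber G g × IsZIR (G ∨K₁) zj × (zj ≡ n ∸ g + 1))
proposition6p3 =
    (λ n G g z noIso ((D , dom , ∣D∣≡g) , γ≤) zir →
      subst (λ k → n ∸ k ≤ z) ∣D∣≡g (ZIR-∨K₁-≥ dom zir) , ZIR-∨K₁-≤ γ≤ noIso zir)
  , (λ n G g z zj noIso (_ , γ≤) ((S , (zirS , _) , ∣S∣≡z) , _) zir z≡n∸g →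
      ZIR-∨K₁-≡ γ≤ noIso zirS (trans ∣S∣≡z z≡n∸g) zir , cong (_+ 1) (sym z≡n∸g))
  , (3 , star 2 , 1 , 2 , from-yes (noIsolated? (star 2))
       , from-yes (isDominationNumber? (star 2) 1) , from-yes (isZIR? (star 2 ∨K₁) 2) , refl)
  , (2 , star 1 , 1 , 2 , from-yes (noIsolated? (star 1))
       , from-yes (isDominationNumber? (star 1) 1) , from-yes (isZIR? (star 1 ∨K₁) 2) , refl)
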